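{- Let $\mathbb{K}$ be a field of characteristic $0$ and $\mathcal{H}$ the $\mathbb{K}$-vector space freely spanned by totally assigned graphs (TAGs). Let $\Delta:\mathcal{H}\to\mathcal{H}\otimes\mathcal{H}$ be defined linearly by $\Delta\big((\Gamma,\mu)\big)=\sum_{\emptyset\subseteq(\gamma,\nu)\subseteq(\Gamma,\mu)}(\gamma,\nu)\otimes(\Gamma/\gamma,\mu/\nu)$ (sum over all totally assigned subgraphs), and let $\epsilon:\mathcal{H}\to\mathbb{K}$ be defined linearly by $\epsilon\big((\Gamma,\mu)\big)=1$ if $(\Gamma,\mu)=1_{\mathcal{H}}$ and $0$ otherwise. Then $(\mathcal{H},\Delta,\epsilon)$ is a coassociative coalgebra with counit.
   Context: Graphs are finite, possibly disconnected, with loops and multiple edges allowed; $E(\Gamma)$ is the edge set. A TAG is a pair $(\Gamma,\mu)$ where $\mu$ is a total order on $E(\Gamma)$; $1_{\mathcal{H}}$ is the empty graph. A subgraph $\gamma$ of $\Gamma$ is the graph formed by a subset of $E(\Gamma)$ together with the vertices these edges are incident to in $\Gamma$. A totally assigned subgraph $(\gamma,\nu)$ of $(\Gamma,\mu)$ is a subgraph with $\nu$ the restriction of $\mu$ to $E(\gamma)$. The shrinking $(\Gamma/\gamma,\mu/\nu)$: $\Gamma/\gamma$ is obtained by contracting each connected component of $\gamma$ to a point, and $\mu/\nu$ is the restriction of $\mu$ to the edges of $\Gamma$ not in $\gamma$. -}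

module Defs where

open import Level using (Level; _⊔_) renaming (suc to lsuc)
open import Data.Nat using (ℕ; suc; _≡ᵇ_)
open import Data.Bool using (if_then_else_)
open import Data.Product using (_×_; _,_; Σ; ∃)
open import Data.Sum using (_⊎_)
open import Data.List using (List; []; _∷_; map; concatMap; foldr)
open import Data.List.Relation.Binary.Pointwise using (Pointwise)
open import Relation.Nullary using (¬_)
open import Relation.Binary.PropositionalEquality using (_≡_)
open import Function using (id)
open import Function.Bundles using (_↔_; Inverse)
open import Algebra.Bundles using (CommutativeRing; Semiring)
import Algebra.Definitions.RawSemiring as RawSemiringDefs

record Field (c ℓ : Level) : Set (lsuc (c ⊔ ℓ)) where
  field
    commutativeRing : CommutativeRing c ℓ
  open CommutativeRing commutativeRing public
  field
    1≉0     : ¬ (1# ≈ 0#)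
    inverse : ∀ x → ¬ (x ≈ 0#) → ∃ λ y → (x * y) ≈ 1#

CharZero : ∀ {c ℓ} → Field c ℓ → Set ℓ
CharZero K = ∀ n → ¬ ((suc n ×ₙ 1#) ≈ 0#)
  where
  open Field K
  open RawSemiringDefs (Semiring.rawSemiring semiring) renaming (_×_ to _×ₙ_)

-- Vertices are labelled by ℕ; an edge is given by its two endpoints
-- (unordered: see _≅_).  A TAG (Γ , μ) is the list of its edges in the
-- order μ (head = μ-smallest edge).  Loops and multiple edges are allowed.
-- Only vertices incident to edges are recorded.

Edge : Set
Edge = ℕ × ℕ

TAG : Set
TAG = List Edge

1H : TAG
1H = []

EdgeMap : (ℕ → ℕ) → Edge → Edge → Set
EdgeMap f (u , v) (u' , v') = (f u ≡ u' × f v ≡ v') ⊎ (f u ≡ v' × f v ≡ u')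

-- isomorphism of TAGs: a relabelling of vertices inducing an
-- order-preserving bijection of edges
_≅_ : TAG → TAG → Set
T ≅ T' = Σ (ℕ ↔ ℕ) λ f → Pointwise (EdgeMap (Inverse.to f)) T T'

-- all totally assigned subgraphs: pairs (edges of γ , remaining edges),
-- both in μ-order; one pair for each subset of E(Γ)
splits : ∀ {A : Set} → List A → List (List A × List A)
splits [] = ([] , []) ∷ []
splits (e ∷ es) =
  concatMap (λ { (s , r) → (e ∷ s , r) ∷ (s , e ∷ r) ∷ [] }) (splits es)

-- rep γ w : representative vertex of the connected component of γ
-- containing w (w itself if w is not a vertex of γ)
rep : TAG → ℕ → ℕ
rep [] = id
rep ((u , v) ∷ es) w =
  if rep es w ≡ᵇ rep es v then rep es u else rep es w

shrink : TAG → List Edge → TAG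
shrink γ rest = map (λ { (u , v) → (rep γ u , rep γ v) }) rest

-- Free vector spaces (formal finite linear combinations modulo the
-- relations of the free K-vector space on the classes of a basis
-- setoid)

module Coalg {c ℓ} (K : Field c ℓ) where
  open Field K

  Free : Set → Set c
  Free B = List (Carrier × B)

  data Eqv {B : Set} (_≃_ : B → B → Set) : Free B → Free B → Set (c ⊔ ℓ) where
    e-refl  : ∀ {x} → Eqv _≃_ x x
    e-sym   : ∀ {x y} → Eqv _≃_ x y → Eqv _≃_ y x
    e-trans : ∀ {x y z} → Eqv _≃_ x y → Eqv _≃_ y z → Eqv _≃_ x z
    e-cons  : ∀ {t x y} → Eqv _≃_ x y → Eqv _≃_ (t ∷ x) (t ∷ y)
    e-swap  : ∀ {s t x} → Eqv _≃_ (s ∷ t ∷ x) (t ∷ s ∷ x)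
    e-coef  : ∀ {a b β β' x} → a ≈ b → β ≃ β' →
              Eqv _≃_ ((a , β) ∷ x) ((b , β') ∷ x)
    e-merge : ∀ {a b β β' x} → β ≃ β' →
              Eqv _≃_ ((a , β) ∷ (b , β') ∷ x) ((a + b , β) ∷ x)
    e-zero  : ∀ {β x} → Eqv _≃_ ((0# , β) ∷ x) x

  -- H, H ⊗ H, H ⊗ H ⊗ H (free on basis tuples of TAG classes)
  H : Set c
  H = Free TAG

  H⊗H : Set c
  H⊗H = Free (TAG × TAG)

  H⊗H⊗H : Set c
  H⊗H⊗H = Free (TAG × TAG × TAG)

  _≅₂_ : TAG × TAG → TAG × TAG → Set
  (a , b) ≅₂ (a' , b') = (a ≅ a') × (b ≅ b')

  _≅₃_ : TAG × TAG × TAG → TAG × TAG × TAG → Set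
  (a , b , d) ≅₃ (a' , b' , d') = (a ≅ a') × (b ≅ b') × (d ≅ d')

  _∼₁_ : H → H → Set (c ⊔ ℓ)
  _∼₁_ = Eqv _≅_

  _∼₂_ : H⊗H → H⊗H → Set (c ⊔ ℓ)
  _∼₂_ = Eqv _≅₂_

  _∼₃_ : H⊗H⊗H → H⊗H⊗H → Set (c ⊔ ℓ)
  _∼₃_ = Eqv _≅₃_

  lin : ∀ {B B' : Set} → (B → Free B') → Free B → Free B'
  lin f = concatMap (λ { (k , b) → map (λ { (k' , b') → (k * k' , b') }) (f b) })

  mapB : ∀ {B B' : Set} → (B → B') → Free B → Free B'
  mapB g = map (λ { (k , b) → (k , g b) })

  Δ₀ : TAG → H⊗H
  Δ₀ Γ = map (λ { (γ , rest) → (1# , (γ , shrink γ rest)) }) (splits Γ)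

  Δ : H → H⊗H
  Δ = lin Δ₀

  ε₀ : TAG → Carrier
  ε₀ [] = 1#
  ε₀ (_ ∷ _) = 0#

  ε : H → Carrier
  ε = foldr (λ { (k , T) s → k * ε₀ T + s }) 0#

  Δ⊗id : H⊗H → H⊗H⊗H
  Δ⊗id = lin (λ { (a , b) → mapB (λ { (x , y) → (x , y , b) }) (Δ₀ a) })

  id⊗Δ : H⊗H → H⊗H⊗H
  id⊗Δ = lin (λ { (a , b) → mapB (λ { (y , z) → (a , y , z) }) (Δ₀ b) })

  -- K ⊗ H ≅ H and H ⊗ K ≅ H
  ε⊗id : H⊗H → H
  ε⊗id = lin (λ { (a , b) → (ε₀ a , b) ∷ [] })

  id⊗ε : H⊗H → H
  id⊗ε = lin (λ { (a , b) → (ε₀ b , a) ∷ [] })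

-- Both iterated coproducts of a TAG Γ are sums over the ordered partitions
-- (δ , s , r) of its edges, each kept in the order μ: (Δ ⊗ id) Δ splits Γ into
-- γ ⊔ r and then γ into δ ⊔ s, while (id ⊗ Δ) Δ splits Γ into δ ⊔ t and then
-- t into s ⊔ r.  The two enumerations are permutations of each other, and
-- matching terms agree up to isomorphism: their last factor is r with δ ∪ s
-- contracted in one step, resp. with δ contracted first and then the image
-- of s, and both identify exactly the vertices joined by a path in δ ∪ s.
-- Every such comparison of contractions reduces to one fact: two idempotent
-- maps of ℕ with the same kernel (two choices of component representatives)
-- differ by a bijection of ℕ.  For the counit, only the split with empty
-- subgraph (resp. empty remainder) survives ε.
module Submission where

open import Level using (_⊔_)
open import Data.Bool using (Bool; true; false; if_then_else_; T)
open import Data.Empty using (⊥-elim)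
open import Data.Unit using (tt)
open import Data.Nat using (ℕ; _≡ᵇ_; _≟_)
open import Data.Nat.Properties using (≡ᵇ⇒≡; ≡⇒≡ᵇ)
open import Data.Product using (_×_; _,_; proj₁; proj₂; Σ-syntax; uncurry)
import Data.Product as Product
import Data.Product.Relation.Binary.Pointwise.NonDependent as ×
open import Data.Sum using (_⊎_; inj₁; inj₂; [_,_]′)
open import Data.List using (List; []; _∷_; _++_; map; concatMap; filterᵇ; null)
open import Data.List.Properties
  using (map-∘; map-++; map-id; concatMap-map; concatMap-cong; map-concatMap; concatMap-++)
open import Data.List.Effectful using (module MonadProperties)
open import Data.List.Relation.Unary.All as All using (All; []; _∷_)
import Data.List.Relation.Unary.All.Properties as All
open import Data.List.Relation.Unary.Any using (here; there)
open import Data.List.Membership.Propositional using (_∈_)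
open import Data.List.Membership.Propositional.Properties
  using (∈-map⁺; ∈-map⁻; ∈-++⁺ˡ; ∈-++⁺ʳ; ∈-++⁻)
open import Data.List.Relation.Binary.Pointwise as Pointwise using (Pointwise; []; _∷_)
open import Data.List.Relation.Binary.Permutation.Propositional as ↭
  using (_↭_; prep; ↭-refl; ↭-trans; ↭-sym; ↭-reflexive)
open import Data.List.Relation.Binary.Permutation.Propositional.Properties
  using (++⁺; ++⁺ˡ; shift; shifts; ∈-resp-↭) renaming (map⁺ to ↭-map⁺)
open import Function using (_∘_; id)
open import Function.Bundles using (_↔_; _⇔_; mk↔ₛ′; mk⇔; Inverse; Equivalence)
open import Function.Construct.Identity using (↔-id)
open import Function.Construct.Composition using (_↔-∘_)
open import Relation.Nullary using (yes; no)
open import Relation.Binary.Bundles using (Setoid)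
open import Relation.Binary.PropositionalEquality
  using (_≡_; _≢_; refl; sym; trans; cong; subst; subst₂; isEquivalence)
open import Algebra.Definitions {A = ℕ} _≡_ using (IdempotentFun)
open import Relation.Binary.Construct.Closure.Equivalence as EqClosure using (EqClosure)
open import Defs

private variable
  A B C : Set

map-map : ∀ {a b c} {A : Set a} {B : Set b} {C : Set c} {f : B → C} {g : A → B} xs →
  map f (map g xs) ≡ map (f ∘ g) xs
map-map xs = sym (map-∘ xs)

map-map₃ : ∀ {a b c d} {A : Set a} {B : Set b} {C : Set c} {D : Set d}
  {f : C → D} {g : B → C} {h : A → B} xs → map f (map g (map h xs)) ≡ map (f ∘ g ∘ h) xs
map-map₃ xs = trans (cong (map _) (map-map xs)) (map-map xs)

map-concatMap-map : ∀ {a b c d} {A : Set a} {B : Set b} {C : Set c} {D : Set d}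
  (f : C → D) {g : A → B → C} {h : A → List B} xs →
  map f (concatMap (λ x → map (g x) (h x)) xs) ≡ concatMap (λ x → map (f ∘ g x) (h x)) xs
map-concatMap-map f xs = trans (map-concatMap f _ xs) (concatMap-cong (λ x → map-map _) xs)

concatMap-concatMap : ∀ (g : B → List C) (f : A → List B) xs →
  concatMap g (concatMap f xs) ≡ concatMap (concatMap g ∘ f) xs
concatMap-concatMap g f xs = sym (MonadProperties.associative xs f g)

concatMap-cong-↭ : ∀ {f g : A → List B} → (∀ x → f x ↭ g x) → ∀ xs →
  concatMap f xs ↭ concatMap g xs
concatMap-cong-↭ f↭g []       = ↭-refl
concatMap-cong-↭ f↭g (x ∷ xs) = ++⁺ (f↭g x) (concatMap-cong-↭ f↭g xs)

concatMap⁺ : ∀ (f : A → List B) {xs ys} → xs ↭ ys → concatMap f xs ↭ concatMap f ys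
concatMap⁺ f ↭.refl         = ↭-refl
concatMap⁺ f (↭.prep x p)   = ++⁺ˡ (f x) (concatMap⁺ f p)
concatMap⁺ f (↭.swap x y p) =
  ↭-trans (shifts (f x) (f y)) (++⁺ˡ (f y) (++⁺ˡ (f x) (concatMap⁺ f p)))
concatMap⁺ f (↭.trans p q)  = ↭-trans (concatMap⁺ f p) (concatMap⁺ f q)

if-≡ᵇ-yes : ∀ {x y} (a b : C) → x ≡ y → (if x ≡ᵇ y then a else b) ≡ a
if-≡ᵇ-yes {x = x} {y} a b x≡y with x ≡ᵇ y in eq
... | true  = refl
... | false = ⊥-elim (subst T eq (≡⇒≡ᵇ x y x≡y))

if-≡ᵇ-no : ∀ {x y} (a b : C) → x ≢ y → (if x ≡ᵇ y then a else b) ≡ b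
if-≡ᵇ-no {x = x} {y} a b x≢y with x ≡ᵇ y in eq
... | true  = ⊥-elim (x≢y (≡ᵇ⇒≡ x y (subst T (sym eq) tt)))
... | false = refl

-- Ordered splittings of a list

-- splits (x ∷ xs) is concatMap (insert₂ x) (splits xs) definitionally.
insert₂ : A → List A × List A → List (List A × List A)
insert₂ x (s , r) = (x ∷ s , r) ∷ (s , x ∷ r) ∷ []

splits-↭ : ∀ (xs : List A) → All (uncurry λ s r → s ++ r ↭ xs) (splits xs)
splits-↭ []       = ↭-refl ∷ []
splits-↭ (x ∷ xs) = All.concat⁺ (All.map⁺ (All.map
  (λ {(s , r)} s++r↭xs → prep x s++r↭xs ∷ ↭-trans (shift x s r) (prep x s++r↭xs) ∷ [])
  (splits-↭ xs)))

splits⁺ : ∀ {R : A → B → Set} {xs ys} → Pointwise R xs ys →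
  Pointwise (×.Pointwise (Pointwise R) (Pointwise R)) (splits xs) (splits ys)
splits⁺ []       = ([] , []) ∷ []
splits⁺ (r ∷ rs) = Pointwise.concat⁺ (Pointwise.map⁺ _ _ (Pointwise.map
  (λ (rs₁ , rs₂) → (r ∷ rs₁ , rs₂) ∷ (rs₁ , r ∷ rs₂) ∷ [])
  (splits⁺ rs)))

splits-map : ∀ (f : A → B) xs →
  splits (map f xs) ≡ map (Product.map (map f) (map f)) (splits xs)
splits-map f []       = refl
splits-map f (x ∷ xs) =
  trans (cong (concatMap _) (splits-map f xs))
    (trans (concatMap-map _ _ (splits xs)) (sym (map-concatMap _ _ (splits xs))))

filterᵇ-null₁-splits : ∀ (xs : List A) → filterᵇ (null ∘ proj₁) (splits xs) ≡ ([] , xs) ∷ []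
filterᵇ-null₁-splits []       = refl
filterᵇ-null₁-splits (x ∷ xs) =
  trans (extend (splits xs)) (cong (map (Product.map₂ (x ∷_))) (filterᵇ-null₁-splits xs))
  where
  extend : ∀ L → filterᵇ (null ∘ proj₁) (concatMap (insert₂ x) L)
                 ≡ map (Product.map₂ (x ∷_)) (filterᵇ (null ∘ proj₁) L)
  extend []                = refl
  extend (([]    , r) ∷ L) = cong (_ ∷_) (extend L)
  extend ((_ ∷ _ , r) ∷ L) = extend L

filterᵇ-null₂-splits : ∀ (xs : List A) → filterᵇ (null ∘ proj₂) (splits xs) ≡ (xs , []) ∷ []
filterᵇ-null₂-splits []       = refl
filterᵇ-null₂-splits (x ∷ xs) =
  trans (extend (splits xs)) (cong (map (Product.map₁ (x ∷_))) (filterᵇ-null₂-splits xs))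
  where
  extend : ∀ L → filterᵇ (null ∘ proj₂) (concatMap (insert₂ x) L)
                 ≡ map (Product.map₁ (x ∷_)) (filterᵇ (null ∘ proj₂) L)
  extend []                = refl
  extend ((s , [])    ∷ L) = cong (_ ∷_) (extend L)
  extend ((s , _ ∷ _) ∷ L) = extend L

splits₃ˡ : List A → List (List A × List A × List A)
splits₃ˡ xs = concatMap (λ (γ , r) → map (λ (δ , s) → δ , s , r) (splits γ)) (splits xs)

splits₃ʳ : List A → List (List A × List A × List A)
splits₃ʳ xs = concatMap (λ (δ , t) → map (λ (s , r) → δ , s , r) (splits t)) (splits xs)

insert₃ : A → List A × List A × List A → List (List A × List A × List A)
insert₃ x (δ , s , r) = (x ∷ δ , s , r) ∷ (δ , x ∷ s , r) ∷ (δ , s , x ∷ r) ∷ []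

splits₃ˡ-∷ : ∀ x (xs : List A) → splits₃ˡ (x ∷ xs) ↭ concatMap (insert₃ x) (splits₃ˡ xs)
splits₃ˡ-∷ x xs = ↭-trans (↭-reflexive (concatMap-concatMap _ _ (splits xs)))
  (↭-trans (concatMap-cong-↭ (λ (γ , r) → extend r (splits γ)) (splits xs))
           (↭-reflexive (sym (concatMap-concatMap _ _ (splits xs)))))
  where
  extend : ∀ r M →
    map (λ (δ , s) → δ , s , r) (concatMap (insert₂ x) M)
      ++ map (λ (δ , s) → δ , s , x ∷ r) M ++ []
    ↭ concatMap (insert₃ x) (map (λ (δ , s) → δ , s , r) M)
  extend r []            = ↭-refl
  extend r ((δ , s) ∷ M) = prep _ (prep _ (↭-trans (shift _ _ _) (prep _ (extend r M))))

splits₃ʳ-∷ : ∀ x (xs : List A) → splits₃ʳ (x ∷ xs) ↭ concatMap (insert₃ x) (splits₃ʳ xs)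
splits₃ʳ-∷ x xs = ↭-trans (↭-reflexive (concatMap-concatMap _ _ (splits xs)))
  (↭-trans (concatMap-cong-↭ (λ (δ , t) → extend δ (splits t)) (splits xs))
           (↭-reflexive (sym (concatMap-concatMap _ _ (splits xs)))))
  where
  extend : ∀ δ M →
    map (λ (s , r) → x ∷ δ , s , r) M
      ++ map (λ (s , r) → δ , s , r) (concatMap (insert₂ x) M) ++ []
    ↭ concatMap (insert₃ x) (map (λ (s , r) → δ , s , r) M)
  extend δ []            = ↭-refl
  extend δ ((s , r) ∷ M) =
    prep _ (↭-trans (shifts (map _ M) (_ ∷ _ ∷ [])) (prep _ (prep _ (extend δ M))))

splits₃ˡ↭splits₃ʳ : ∀ (xs : List A) → splits₃ˡ xs ↭ splits₃ʳ xs
splits₃ˡ↭splits₃ʳ []       = ↭-refl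
splits₃ˡ↭splits₃ʳ (x ∷ xs) = ↭-trans (splits₃ˡ-∷ x xs)
  (↭-trans (concatMap⁺ (insert₃ x) (splits₃ˡ↭splits₃ʳ xs)) (↭-sym (splits₃ʳ-∷ x xs)))

-- Bijections of ℕ relating idempotent maps with a common kernel

module _ {p q : ℕ → ℕ} (p-idem : IdempotentFun p) (q-idem : IdempotentFun q)
         (same-kernel : ∀ x y → p x ≡ p y ⇔ q x ≡ q y) where

  private
    p⇒q : ∀ {x y} → p x ≡ p y → q x ≡ q y
    p⇒q = Equivalence.to (same-kernel _ _)

    q⇒p : ∀ {x y} → q x ≡ q y → p x ≡ p y
    q⇒p = Equivalence.from (same-kernel _ _)

    -- Fixed points of p and of q are both representatives of the common
    -- kernel classes; exchange swaps the two representatives of each class.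
    exchange : ℕ → ℕ
    exchange x = if p x ≡ᵇ x then q x else (if q x ≡ᵇ x then p x else x)

    exchange-p-fixed : ∀ {x} → p x ≡ x → exchange x ≡ q x
    exchange-p-fixed = if-≡ᵇ-yes _ _

    exchange-q-fixed : ∀ {x} → p x ≢ x → q x ≡ x → exchange x ≡ p x
    exchange-q-fixed px≢x qx≡x = trans (if-≡ᵇ-no _ _ px≢x) (if-≡ᵇ-yes _ _ qx≡x)

    exchange-other : ∀ {x} → p x ≢ x → q x ≢ x → exchange x ≡ x
    exchange-other px≢x qx≢x = trans (if-≡ᵇ-no _ _ px≢x) (if-≡ᵇ-no _ _ qx≢x)

    exchange-involutive : ∀ x → exchange (exchange x) ≡ x
    exchange-involutive x with p x ≟ x
    ... | yes px≡x = trans (cong exchange (exchange-p-fixed px≡x)) back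
      where
      p[qx]≡x : p (q x) ≡ x
      p[qx]≡x = trans (q⇒p (q-idem x)) px≡x
      back : exchange (q x) ≡ x
      back with p (q x) ≟ q x
      ... | yes p[qx]≡qx = trans (exchange-p-fixed p[qx]≡qx)
                             (trans (q-idem x) (trans (sym p[qx]≡qx) p[qx]≡x))
      ... | no  p[qx]≢qx = trans (exchange-q-fixed p[qx]≢qx (q-idem x)) p[qx]≡x
    ... | no px≢x with q x ≟ x
    ...   | yes qx≡x = trans (cong exchange (exchange-q-fixed px≢x qx≡x))
                         (trans (exchange-p-fixed (p-idem x)) (trans (p⇒q (p-idem x)) qx≡x))
    ...   | no  qx≢x = trans (cong exchange (exchange-other px≢x qx≢x)) (exchange-other px≢x qx≢x)

  kernelBijection : Σ[ h ∈ ℕ ↔ ℕ ] (∀ w → Inverse.to h (p w) ≡ q w)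
  kernelBijection = mk↔ₛ′ exchange exchange exchange-involutive exchange-involutive
                  , λ w → trans (exchange-p-fixed (p-idem w)) (p⇒q (p-idem w))

module _ (f : ℕ ↔ ℕ) where
  open Inverse f

  relabelBijection : ∀ {p q} → IdempotentFun p → IdempotentFun q →
    (∀ x y → p x ≡ p y ⇔ q (to x) ≡ q (to y)) →
    Σ[ h ∈ ℕ ↔ ℕ ] (∀ w → Inverse.to h (p w) ≡ q (to w))
  relabelBijection {p} {q} p-idem q-idem same-kernel =
    let h , h∘p≡q′ = kernelBijection p-idem q′-idem same-kernel′
    in f ↔-∘ h , λ w → trans (cong to (h∘p≡q′ w)) (strictlyInverseˡ (q (to w)))
    where
    q′ : ℕ → ℕ
    q′ = from ∘ q ∘ to

    q′-idem : IdempotentFun q′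
    q′-idem w = cong from (trans (cong q (strictlyInverseˡ (q (to w)))) (q-idem (to w)))

    from-injective : ∀ {a b} → from a ≡ from b → a ≡ b
    from-injective {a} {b} eq =
      trans (sym (strictlyInverseˡ a)) (trans (cong to eq) (strictlyInverseˡ b))

    same-kernel′ : ∀ x y → p x ≡ p y ⇔ q′ x ≡ q′ y
    same-kernel′ x y = mk⇔ (cong from ∘ Equivalence.to (same-kernel x y))
                           (Equivalence.from (same-kernel x y) ∘ from-injective)

-- Connected components and their representatives

Connected : TAG → ℕ → ℕ → Set
Connected γ = EqClosure (λ u v → (u , v) ∈ γ)

module ConnectedReasoning (γ : TAG) where
  open import Relation.Binary.Reasoning.Setoid (EqClosure.setoid (λ u v → (u , v) ∈ γ)) public

edge : ∀ {γ u v} → (u , v) ∈ γ → Connected γ u v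
edge = EqClosure.return

Connected-sym : ∀ {γ x y} → Connected γ x y → Connected γ y x
Connected-sym = EqClosure.symmetric _

Connected-mono : ∀ {γ γ′} → (∀ {e} → e ∈ γ → e ∈ γ′) →
  ∀ {x y} → Connected γ x y → Connected γ′ x y
Connected-mono γ⊆γ′ = EqClosure.map γ⊆γ′

rep-∷ : ∀ u v es w →
  (rep es w ≡ rep es v × rep ((u , v) ∷ es) w ≡ rep es u) ⊎ rep ((u , v) ∷ es) w ≡ rep es w
rep-∷ u v es w with rep es w ≟ rep es v
... | yes eq  = inj₁ (eq , if-≡ᵇ-yes _ _ eq)
... | no  neq = inj₂ (if-≡ᵇ-no _ _ neq)

rep-edge : ∀ γ {u v} → (u , v) ∈ γ → rep γ u ≡ rep γ v
rep-edge ((u , v) ∷ es) (here refl) =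
  trans ([ proj₂ , id ]′ (rep-∷ u v es u)) (sym (if-≡ᵇ-yes {x = rep es v} _ _ refl))
rep-edge ((a , b) ∷ es) (there uv∈es) =
  cong (λ z → if z ≡ᵇ rep es b then rep es a else z) (rep-edge es uv∈es)

Connected⇒rep≡ : ∀ γ {x y} → Connected γ x y → rep γ x ≡ rep γ y
Connected⇒rep≡ γ = EqClosure.gfold isEquivalence (rep γ) (rep-edge γ)

Connected-rep : ∀ γ w → Connected γ w (rep γ w)
Connected-rep []             w = EqClosure.reflexive _
Connected-rep ((u , v) ∷ es) w with rep-∷ u v es w
... | inj₁ (rw≡rv , eq) = subst (Connected _ w) (sym eq) (begin
  w        ≈⟨ lift (Connected-rep es w) ⟩
  rep es w ≡⟨ rw≡rv ⟩
  rep es v ≈⟨ lift (Connected-sym (Connected-rep es v)) ⟩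
  v        ≈⟨ Connected-sym (edge (here refl)) ⟩
  u        ≈⟨ lift (Connected-rep es u) ⟩
  rep es u ∎)
  where
  open ConnectedReasoning ((u , v) ∷ es)
  lift : ∀ {x y} → Connected es x y → Connected ((u , v) ∷ es) x y
  lift = Connected-mono there
... | inj₂ eq = subst (Connected _ w) (sym eq) (Connected-mono there (Connected-rep es w))

rep≡⇒Connected : ∀ γ {x y} → rep γ x ≡ rep γ y → Connected γ x y
rep≡⇒Connected γ {x} {y} eq = begin
  x       ≈⟨ Connected-rep γ x ⟩
  rep γ x ≡⟨ eq ⟩
  rep γ y ≈⟨ Connected-sym (Connected-rep γ y) ⟩
  y       ∎
  where open ConnectedReasoning γ

rep≡⇔Connected : ∀ γ {x y} → rep γ x ≡ rep γ y ⇔ Connected γ x y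
rep≡⇔Connected γ = mk⇔ (rep≡⇒Connected γ) (Connected⇒rep≡ γ)

rep-idem : ∀ γ → IdempotentFun (rep γ)
rep-idem γ w = sym (Connected⇒rep≡ γ (Connected-rep γ w))

rep-preserves : ∀ (P : ℕ → Set) γ → (∀ {u v} → (u , v) ∈ γ → P u) →
  ∀ {w} → P w → P (rep γ w)
rep-preserves P []             P-src Pw = Pw
rep-preserves P ((u , v) ∷ es) P-src {w} Pw with rep-∷ u v es w
... | inj₁ (_ , eq) = subst P (sym eq) (rep-preserves P es (P-src ∘ there) (P-src (here refl)))
... | inj₂ eq       = subst P (sym eq) (rep-preserves P es (P-src ∘ there) Pw)

-- Invariance of shrinking

mapEdges : (ℕ → ℕ) → TAG → TAG
mapEdges p = map (λ (u , v) → p u , p v)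

mapEdges-EdgeMap : ∀ {f h p q : ℕ → ℕ} → (∀ w → h (p w) ≡ q (f w)) →
  ∀ {r r′} → Pointwise (EdgeMap f) r r′ → Pointwise (EdgeMap h) (mapEdges p r) (mapEdges q r′)
mapEdges-EdgeMap {f} {h} {p} {q} h∘p≡q∘f = Pointwise.map⁺ _ _ ∘ Pointwise.map image
  where
  image : ∀ {e e′} → EdgeMap f e e′ →
    EdgeMap h (p (proj₁ e) , p (proj₂ e)) (q (proj₁ e′) , q (proj₂ e′))
  image (inj₁ (refl , refl)) = inj₁ (h∘p≡q∘f _ , h∘p≡q∘f _)
  image (inj₂ (refl , refl)) = inj₂ (h∘p≡q∘f _ , h∘p≡q∘f _)

mapEdges-≅ : ∀ (f : ℕ ↔ ℕ) {p q} → IdempotentFun p → IdempotentFun q →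
  (∀ x y → p x ≡ p y ⇔ q (Inverse.to f x) ≡ q (Inverse.to f y)) →
  ∀ {r r′} → Pointwise (EdgeMap (Inverse.to f)) r r′ → mapEdges p r ≅ mapEdges q r′
mapEdges-≅ f p-idem q-idem same-kernel rr′ =
  let h , h∘p≡q∘f = relabelBijection f p-idem q-idem same-kernel
  in h , mapEdges-EdgeMap h∘p≡q∘f rr′

EdgeMap-id : ∀ r → Pointwise (EdgeMap id) r r
EdgeMap-id r = Pointwise.refl (inj₁ (refl , refl))

≅-refl : ∀ {T} → T ≅ T
≅-refl {T} = ↔-id ℕ , EdgeMap-id T

EdgeMap-inverse : ∀ (f : ℕ ↔ ℕ) {γ γ′} → Pointwise (EdgeMap (Inverse.to f)) γ γ′ →
  Pointwise (EdgeMap (Inverse.from f)) γ′ γ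
EdgeMap-inverse f = Pointwise.symmetric λ where
    (inj₁ (refl , refl)) → inj₁ (strictlyInverseʳ _ , strictlyInverseʳ _)
    (inj₂ (refl , refl)) → inj₂ (strictlyInverseʳ _ , strictlyInverseʳ _)
  where open Inverse f

Connected-EdgeMap : ∀ {f γ γ′} → Pointwise (EdgeMap f) γ γ′ →
  ∀ {x y} → Connected γ x y → Connected γ′ (f x) (f y)
Connected-EdgeMap {f} γγ′ = EqClosure.join ∘ EqClosure.gmap f (image γγ′)
  where
  image : ∀ {γ γ′} → Pointwise (EdgeMap f) γ γ′ →
    ∀ {u v} → (u , v) ∈ γ → Connected γ′ (f u) (f v)
  image (inj₁ (refl , refl) ∷ _) (here refl) = edge (here refl)
  image (inj₂ (refl , refl) ∷ _) (here refl) = Connected-sym (edge (here refl))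
  image (_ ∷ γγ′)                (there uv∈γ) = Connected-mono there (image γγ′ uv∈γ)

shrink-≅ : ∀ (f : ℕ ↔ ℕ) {γ γ′ r r′} → Pointwise (EdgeMap (Inverse.to f)) γ γ′ →
  Pointwise (EdgeMap (Inverse.to f)) r r′ → shrink γ r ≅ shrink γ′ r′
shrink-≅ f {γ} {γ′} γγ′ = mapEdges-≅ f (rep-idem γ) (rep-idem γ′) λ x y → mk⇔
  (Connected⇒rep≡ γ′ ∘ Connected-EdgeMap γγ′ ∘ rep≡⇒Connected γ)
  (Connected⇒rep≡ γ ∘ subst₂ (Connected γ) (strictlyInverseʳ x) (strictlyInverseʳ y)
    ∘ Connected-EdgeMap (EdgeMap-inverse f γγ′) ∘ rep≡⇒Connected γ′)
  where open Inverse f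

shrink-↭ : ∀ {γ γ′} → γ ↭ γ′ → ∀ r → shrink γ r ≅ shrink γ′ r
shrink-↭ {γ} {γ′} γ↭γ′ r = mapEdges-≅ (↔-id ℕ) (rep-idem γ) (rep-idem γ′) (λ _ _ → mk⇔
  (Connected⇒rep≡ γ′ ∘ Connected-mono (∈-resp-↭ γ↭γ′) ∘ rep≡⇒Connected γ)
  (Connected⇒rep≡ γ ∘ Connected-mono (∈-resp-↭ (↭-sym γ↭γ′)) ∘ rep≡⇒Connected γ′))
  (EdgeMap-id r)

shrink-++ : ∀ δ s r → shrink (δ ++ s) r ≅ shrink (shrink δ s) (shrink δ r)
shrink-++ δ s r = subst (shrink (δ ++ s) r ≅_) (sym (map-map r))
  (mapEdges-≅ (↔-id ℕ) (rep-idem (δ ++ s)) q-idem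
    (λ _ _ → mk⇔ (collapse ∘ rep≡⇒Connected (δ ++ s)) (Connected⇒rep≡ (δ ++ s) ∘ expand))
    (EdgeMap-id r))
  where
  σ : TAG
  σ = shrink δ s

  q : ℕ → ℕ
  q = rep σ ∘ rep δ

  q-idem : IdempotentFun q
  q-idem w =
    trans (cong (rep σ) (rep-preserves (λ z → rep δ z ≡ z) σ sources-fixed (rep-idem δ w)))
          (rep-idem σ (rep δ w))
    where
    sources-fixed : ∀ {u v} → (u , v) ∈ σ → rep δ u ≡ u
    sources-fixed uv∈σ with ∈-map⁻ _ uv∈σ
    ... | (a , b) , _ , refl = rep-idem δ a

  collapse : ∀ {x y} → Connected (δ ++ s) x y → q x ≡ q y
  collapse = EqClosure.gfold isEquivalence q (case-edge ∘ ∈-++⁻ δ)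
    where
    case-edge : ∀ {u v} → (u , v) ∈ δ ⊎ (u , v) ∈ s → q u ≡ q v
    case-edge (inj₁ uv∈δ) = cong (rep σ) (rep-edge δ uv∈δ)
    case-edge (inj₂ uv∈s) = rep-edge σ (∈-map⁺ _ uv∈s)

  toRep : ∀ w → Connected (δ ++ s) w (rep δ w)
  toRep w = Connected-mono ∈-++⁺ˡ (Connected-rep δ w)

  σ-edge : ∀ {u v} → (u , v) ∈ σ → Connected (δ ++ s) u v
  σ-edge uv∈σ with ∈-map⁻ _ uv∈σ
  ... | (a , b) , ab∈s , refl = begin
    rep δ a ≈⟨ Connected-sym (toRep a) ⟩
    a       ≈⟨ edge (∈-++⁺ʳ δ ab∈s) ⟩
    b       ≈⟨ toRep b ⟩
    rep δ b ∎
    where open ConnectedReasoning (δ ++ s)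

  expand : ∀ {x y} → q x ≡ q y → Connected (δ ++ s) x y
  expand {x} {y} qx≡qy = begin
    x       ≈⟨ toRep x ⟩
    rep δ x ≈⟨ EqClosure.join (EqClosure.map σ-edge (rep≡⇒Connected σ qx≡qy)) ⟩
    rep δ y ≈⟨ Connected-sym (toRep y) ⟩
    y       ∎
    where open ConnectedReasoning (δ ++ s)

-- Formal linear combinations

module Linear {c ℓ} (K : Field c ℓ) where
  open Field K renaming (refl to ≈-refl; sym to ≈-sym; trans to ≈-trans)
  open Coalg K

  scale : ∀ {B : Set} → Carrier → Free B → Free B
  scale k = map (λ (a , β) → k * a , β)

  module _ {B : Set} {_≃_ : B → B → Set} where

    private
      infix 4 _∼_
      _∼_ : Free B → Free B → Set (c ⊔ ℓ)
      _∼_ = Eqv _≃_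

    _≋_ : Carrier × B → Carrier × B → Set ℓ
    (a , β) ≋ (b , β′) = a ≈ b × β ≃ β′

    ≡⇒∼ : ∀ {x y} → x ≡ y → x ∼ y
    ≡⇒∼ refl = e-refl

    ∼-++⁺ˡ : ∀ x {y y′} → y ∼ y′ → x ++ y ∼ x ++ y′
    ∼-++⁺ˡ []      y∼y′ = y∼y′
    ∼-++⁺ˡ (t ∷ x) y∼y′ = e-cons (∼-++⁺ˡ x y∼y′)

    ∼-++⁺ʳ : ∀ y {x x′} → x ∼ x′ → x ++ y ∼ x′ ++ y
    ∼-++⁺ʳ y e-refl          = e-refl
    ∼-++⁺ʳ y (e-sym p)       = e-sym (∼-++⁺ʳ y p)
    ∼-++⁺ʳ y (e-trans p q)   = e-trans (∼-++⁺ʳ y p) (∼-++⁺ʳ y q)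
    ∼-++⁺ʳ y (e-cons p)      = e-cons (∼-++⁺ʳ y p)
    ∼-++⁺ʳ y e-swap          = e-swap
    ∼-++⁺ʳ y (e-coef a≈b β≃) = e-coef a≈b β≃
    ∼-++⁺ʳ y (e-merge β≃)    = e-merge β≃
    ∼-++⁺ʳ y e-zero          = e-zero

    ∼-++⁺ : ∀ {x x′ y y′} → x ∼ x′ → y ∼ y′ → x ++ y ∼ x′ ++ y′
    ∼-++⁺ {x′ = x′} x∼x′ y∼y′ = e-trans (∼-++⁺ʳ _ x∼x′) (∼-++⁺ˡ x′ y∼y′)

    ↭⇒∼ : ∀ {x y} → x ↭ y → x ∼ y
    ↭⇒∼ ↭.refl         = e-refl
    ↭⇒∼ (↭.prep t p)   = e-cons (↭⇒∼ p)
    ↭⇒∼ (↭.swap s t p) = e-trans e-swap (e-cons (e-cons (↭⇒∼ p)))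
    ↭⇒∼ (↭.trans p q)  = e-trans (↭⇒∼ p) (↭⇒∼ q)

    map⁺-∼ : ∀ {F : A → Carrier × B} {G : C → Carrier × B} {xs ys} →
      Pointwise (λ a b → F a ≋ G b) xs ys → map F xs ∼ map G ys
    map⁺-∼ []                  = e-refl
    map⁺-∼ ((a≈b , β≃β′) ∷ ps) = e-trans (e-coef a≈b β≃β′) (e-cons (map⁺-∼ ps))

    map-cong-∼ : ∀ {a} {A : Set a} {F G : A → Carrier × B} {xs} →
      All (λ x → F x ≋ G x) xs → map F xs ∼ map G xs
    map-cong-∼ []                  = e-refl
    map-cong-∼ ((a≈b , β≃β′) ∷ ps) = e-trans (e-coef a≈b β≃β′) (e-cons (map-cong-∼ ps))

    concatMap-cong-∼ : ∀ {a} {A : Set a} {f g : A → Free B} → (∀ x → f x ∼ g x) → ∀ xs →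
      concatMap f xs ∼ concatMap g xs
    concatMap-cong-∼ f∼g []       = e-refl
    concatMap-cong-∼ f∼g (x ∷ xs) = ∼-++⁺ (f∼g x) (concatMap-cong-∼ f∼g xs)

    module _ (≃-refl : ∀ {β} → β ≃ β) where

      map-drop-zeros : ∀ (p : A → Bool) (F : A → Carrier × B) →
        (∀ x → p x ≡ false → proj₁ (F x) ≈ 0#) → ∀ xs → map F xs ∼ map F (filterᵇ p xs)
      map-drop-zeros p F zero [] = e-refl
      map-drop-zeros p F zero (x ∷ xs) with p x in eq
      ... | true  = e-cons (map-drop-zeros p F zero xs)
      ... | false = e-trans (e-coef (zero x eq) ≃-refl) (e-trans e-zero (map-drop-zeros p F zero xs))

      scale-≈ : ∀ {a b} → a ≈ b → ∀ x → scale a x ∼ scale b x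
      scale-≈ a≈b x = map-cong-∼ (All.tabulate (λ _ → *-cong a≈b ≈-refl , ≃-refl))

      scale-scale : ∀ a b x → scale a (scale b x) ∼ scale (a * b) x
      scale-scale a b x = e-trans (≡⇒∼ (sym (map-∘ x)))
        (map-cong-∼ (All.tabulate (λ _ → ≈-sym (*-assoc a b _) , ≃-refl)))

      scale-0# : ∀ x y → scale 0# x ++ y ∼ y
      scale-0# []            y = e-refl
      scale-0# ((a , β) ∷ x) y = e-trans (e-coef (zeroˡ a) ≃-refl) (e-trans e-zero (scale-0# x y))

      scale-+ : ∀ a b x y → scale a x ++ scale b x ++ y ∼ scale (a + b) x ++ y
      scale-+ a b []            y = e-refl
      scale-+ a b ((k , β) ∷ x) y = e-trans (↭⇒∼ (prep _ (shift _ (scale a x) _)))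
        (e-trans (e-merge ≃-refl)
        (e-trans (e-coef (≈-sym (distribʳ k a b)) ≃-refl)
                 (e-cons (scale-+ a b x y))))

      scale-cong : ∀ k {x y} → x ∼ y → scale k x ∼ scale k y
      scale-cong k e-refl          = e-refl
      scale-cong k (e-sym p)       = e-sym (scale-cong k p)
      scale-cong k (e-trans p q)   = e-trans (scale-cong k p) (scale-cong k q)
      scale-cong k (e-cons p)      = e-cons (scale-cong k p)
      scale-cong k e-swap          = e-swap
      scale-cong k (e-coef a≈b β≃) = e-coef (*-cong ≈-refl a≈b) β≃
      scale-cong k (e-merge {a} {b} β≃) =
        e-trans (e-merge β≃) (e-coef (≈-sym (distribˡ k a b)) ≃-refl)
      scale-cong k e-zero          = e-trans (e-coef (zeroʳ k) ≃-refl) e-zero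

  Eqv-setoid : ∀ {B : Set} (_≃_ : B → B → Set) → Setoid c (c ⊔ ℓ)
  Eqv-setoid {B} _≃_ = record
    { Carrier       = Free B
    ; _≈_           = Eqv _≃_
    ; isEquivalence = record { refl = e-refl ; sym = e-sym ; trans = e-trans }
    }

  lin-[] : ∀ {B B′ : Set} (φ : B′ → Carrier × B) x →
    lin (λ β → φ β ∷ []) x ≡ map (λ (k , β) → k * proj₁ (φ β) , proj₂ (φ β)) x
  lin-[] φ []            = refl
  lin-[] φ ((k , β) ∷ x) = cong (_ ∷_) (lin-[] φ x)

  lin-++ : ∀ {B B′ : Set} (f : B → Free B′) x y → lin f (x ++ y) ≡ lin f x ++ lin f y
  lin-++ f = concatMap-++ _

  module _ {B : Set} {_≃_ : B → B → Set} (≃-refl : ∀ {β} → β ≃ β) where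

    private
      infix 4 _∼_
      _∼_ : Free B → Free B → Set (c ⊔ ℓ)
      _∼_ = Eqv _≃_

    lin-unit : ∀ x → lin (λ β → (1# , β) ∷ []) x ∼ x
    lin-unit []            = e-refl
    lin-unit ((k , β) ∷ x) = e-trans (e-coef (*-identityʳ k) ≃-refl) (e-cons (lin-unit x))

    lin-cong : ∀ {B′ : Set} {f g : B′ → Free B} → (∀ β → f β ∼ g β) →
      ∀ x → lin f x ∼ lin g x
    lin-cong f∼g = concatMap-cong-∼ (λ (k , β) → scale-cong ≃-refl k (f∼g β))

    lin-resp : ∀ {B′ : Set} {_≃′_ : B′ → B′ → Set} {f : B′ → Free B} →
      (∀ {β β′} → β ≃′ β′ → f β ∼ f β′) → ∀ {x y} → Eqv _≃′_ x y → lin f x ∼ lin f y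
    lin-resp f-resp e-refl        = e-refl
    lin-resp f-resp (e-sym p)     = e-sym (lin-resp f-resp p)
    lin-resp f-resp (e-trans p q) = e-trans (lin-resp f-resp p) (lin-resp f-resp q)
    lin-resp {f = f} f-resp (e-cons {t = k , β} p) = ∼-++⁺ˡ (scale k (f β)) (lin-resp f-resp p)
    lin-resp {f = f} f-resp (e-swap {s = a , β} {t = b , β′}) =
      ↭⇒∼ (shifts (scale a (f β)) (scale b (f β′)))
    lin-resp {f = f} f-resp (e-coef {b = b} {x = x} a≈b β≃β′) =
      ∼-++⁺ʳ (lin f x) (e-trans (scale-≈ ≃-refl a≈b _) (scale-cong ≃-refl b (f-resp β≃β′)))
    lin-resp {f = f} f-resp (e-merge {a} {b} {β} {x = x} β≃β′) =
      e-trans (∼-++⁺ˡ (scale a (f β))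
                (∼-++⁺ʳ (lin f x) (scale-cong ≃-refl b (e-sym (f-resp β≃β′)))))
              (scale-+ ≃-refl a b (f β) (lin f x))
    lin-resp {f = f} f-resp (e-zero {β} {x}) = scale-0# ≃-refl (f β) (lin f x)

    lin-scale : ∀ {B′ : Set} (g : B′ → Free B) k x → lin g (scale k x) ∼ scale k (lin g x)
    lin-scale g k []            = e-refl
    lin-scale g k ((a , β) ∷ x) =
      e-trans (∼-++⁺ (e-sym (scale-scale ≃-refl k a (g β))) (lin-scale g k x))
              (≡⇒∼ (sym (map-++ _ (scale a (g β)) (lin g x))))

    lin-lin : ∀ {B′ B″ : Set} (f : B″ → Free B′) (g : B′ → Free B) x →
      lin g (lin f x) ∼ lin (lin g ∘ f) x
    lin-lin f g []            = e-refl
    lin-lin f g ((k , β) ∷ x) = e-trans (≡⇒∼ (lin-++ g (scale k (f β)) (lin f x)))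
      (∼-++⁺ (lin-scale g k (f β)) (lin-lin f g x))

-- The coalgebra of TAGs

module TAGCoalgebra {c ℓ} (K : Field c ℓ) where
  open Field K renaming (refl to ≈-refl; sym to ≈-sym; trans to ≈-trans)
  open Coalg K
  open Linear K
  open import Algebra.Properties.CommutativeSemigroup +-commutativeSemigroup using (x∙yz≈y∙xz)

  ≅₂-refl : ∀ {b} → b ≅₂ b
  ≅₂-refl = ≅-refl , ≅-refl

  ≅₃-refl : ∀ {b} → b ≅₃ b
  ≅₃-refl = ≅-refl , ≅-refl , ≅-refl

  Δ₀-resp : ∀ {Γ Γ′} → Γ ≅ Γ′ → Δ₀ Γ ∼₂ Δ₀ Γ′
  Δ₀-resp (f , ΓΓ′) = map⁺-∼ (Pointwise.map
    (λ (γγ′ , rr′) → ≈-refl , (f , γγ′) , shrink-≅ f γγ′ rr′)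
    (splits⁺ ΓΓ′))

  Δ-resp : ∀ {x y} → x ∼₁ y → Δ x ∼₂ Δ y
  Δ-resp = lin-resp ≅₂-refl Δ₀-resp

  ε₀-resp : ∀ {Γ Γ′} → Γ ≅ Γ′ → ε₀ Γ ≈ ε₀ Γ′
  ε₀-resp (_ , [])    = ≈-refl
  ε₀-resp (_ , _ ∷ _) = ≈-refl

  ε-resp : ∀ {x y} → x ∼₁ y → ε x ≈ ε y
  ε-resp e-refl                    = ≈-refl
  ε-resp (e-sym p)                 = ≈-sym (ε-resp p)
  ε-resp (e-trans p q)             = ≈-trans (ε-resp p) (ε-resp q)
  ε-resp (e-cons p)                = +-cong ≈-refl (ε-resp p)
  ε-resp e-swap                    = x∙yz≈y∙xz _ _ _
  ε-resp (e-coef a≈b Γ≅Γ′)         = +-cong (*-cong a≈b (ε₀-resp Γ≅Γ′)) ≈-refl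
  ε-resp (e-merge {a} {b} {Γ} {Γ′} {x} Γ≅Γ′) = begin
    a * ε₀ Γ + (b * ε₀ Γ′ + ε x)
      ≈⟨ +-cong ≈-refl (+-cong (*-cong ≈-refl (≈-sym (ε₀-resp Γ≅Γ′))) ≈-refl) ⟩
    a * ε₀ Γ + (b * ε₀ Γ + ε x)  ≈⟨ ≈-sym (+-assoc _ _ _) ⟩
    a * ε₀ Γ + b * ε₀ Γ + ε x    ≈⟨ +-cong (≈-sym (distribʳ (ε₀ Γ) a b)) ≈-refl ⟩
    (a + b) * ε₀ Γ + ε x         ∎
    where open import Relation.Binary.Reasoning.Setoid setoid
  ε-resp e-zero                    = ≈-trans (+-cong (zeroˡ _) ≈-refl) (+-identityˡ _)

  counitˡ₀ : ∀ Γ → ε⊗id (Δ₀ Γ) ∼₁ ((1# , Γ) ∷ [])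
  counitˡ₀ Γ = begin
    ε⊗id (Δ₀ Γ)
      ≡⟨ trans (lin-[] (λ (a , b) → ε₀ a , b) (Δ₀ Γ)) (map-map (splits Γ)) ⟩
    map term (splits Γ)
      ≈⟨ map-drop-zeros ≅-refl (null ∘ proj₁) term vanishes (splits Γ) ⟩
    map term (filterᵇ (null ∘ proj₁) (splits Γ))
      ≡⟨ cong (map term) (filterᵇ-null₁-splits Γ) ⟩
    (1# * 1# , shrink [] Γ) ∷ []
      ≈⟨ e-coef (*-identityʳ 1#) (subst (shrink [] Γ ≅_) (map-id Γ) ≅-refl) ⟩
    (1# , Γ) ∷ [] ∎
    where
    open import Relation.Binary.Reasoning.Setoid (Eqv-setoid _≅_)
    term : TAG × TAG → Carrier × TAG
    term (γ , r) = 1# * ε₀ γ , shrink γ r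
    vanishes : ∀ x → null (proj₁ x) ≡ false → proj₁ (term x) ≈ 0#
    vanishes (_ ∷ _ , _) refl = zeroʳ 1#

  counitʳ₀ : ∀ Γ → id⊗ε (Δ₀ Γ) ∼₁ ((1# , Γ) ∷ [])
  counitʳ₀ Γ = begin
    id⊗ε (Δ₀ Γ)
      ≡⟨ trans (lin-[] (λ (a , b) → ε₀ b , a) (Δ₀ Γ)) (map-map (splits Γ)) ⟩
    map term (splits Γ)
      ≈⟨ map-drop-zeros ≅-refl (null ∘ proj₂) term vanishes (splits Γ) ⟩
    map term (filterᵇ (null ∘ proj₂) (splits Γ))
      ≡⟨ cong (map term) (filterᵇ-null₂-splits Γ) ⟩
    (1# * 1# , Γ) ∷ []
      ≈⟨ e-coef (*-identityʳ 1#) ≅-refl ⟩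
    (1# , Γ) ∷ [] ∎
    where
    open import Relation.Binary.Reasoning.Setoid (Eqv-setoid _≅_)
    term : TAG × TAG → Carrier × TAG
    term (γ , r) = 1# * ε₀ (shrink γ r) , γ
    vanishes : ∀ x → null (proj₂ x) ≡ false → proj₁ (term x) ≈ 0#
    vanishes (_ , _ ∷ _) refl = zeroʳ 1#

  coassoc₀ : ∀ Γ → Δ⊗id (Δ₀ Γ) ∼₃ id⊗Δ (Δ₀ Γ)
  coassoc₀ Γ = begin
    Δ⊗id (Δ₀ Γ)                 ≡⟨ Δ⊗id-Δ₀ ⟩
    concatMap termsˡ (splits Γ) ≈⟨ e-trans (concatMap-cong-∼ contract (splits Γ))
                                           (≡⇒∼ (sym (map-concatMap-map termˡ (splits Γ)))) ⟩
    map termˡ (splits₃ˡ Γ)      ≈⟨ ↭⇒∼ (↭-map⁺ termˡ (splits₃ˡ↭splits₃ʳ Γ)) ⟩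
    map termˡ (splits₃ʳ Γ)      ≈⟨ map-cong-∼ (All.tabulate λ {(δ , s , r)} _ →
                                     ≈-refl , ≅-refl , ≅-refl , shrink-++ δ s r) ⟩
    map termʳ (splits₃ʳ Γ)      ≡⟨ id⊗Δ-Δ₀ ⟨
    id⊗Δ (Δ₀ Γ)                 ∎
    where
    open import Relation.Binary.Reasoning.Setoid (Eqv-setoid _≅₃_)

    termˡ termʳ : TAG × TAG × TAG → Carrier × (TAG × TAG × TAG)
    termˡ (δ , s , r) = 1# * 1# , δ , shrink δ s , shrink (δ ++ s) r
    termʳ (δ , s , r) = 1# * 1# , δ , shrink δ s , shrink (shrink δ s) (shrink δ r)

    termsˡ : TAG × TAG → H⊗H⊗H
    termsˡ (γ , r) = map (λ (δ , s) → 1# * 1# , δ , shrink δ s , shrink γ r) (splits γ)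

    Δ⊗id-Δ₀ : Δ⊗id (Δ₀ Γ) ≡ concatMap termsˡ (splits Γ)
    Δ⊗id-Δ₀ = trans (concatMap-map _ _ (splits Γ))
                    (concatMap-cong (map-map₃ ∘ splits ∘ proj₁) (splits Γ))

    contract : ∀ γr → termsˡ γr ∼₃ map (λ (δ , s) → termˡ (δ , s , proj₂ γr)) (splits (proj₁ γr))
    contract (γ , r) = map-cong-∼ (All.map
      (λ δ++s↭γ → ≈-refl , ≅-refl , ≅-refl , shrink-↭ (↭-sym δ++s↭γ) r) (splits-↭ γ))

    id⊗Δ-Δ₀ : id⊗Δ (Δ₀ Γ) ≡ map termʳ (splits₃ʳ Γ)
    id⊗Δ-Δ₀ = trans (concatMap-map _ _ (splits Γ))
      (trans (concatMap-cong (λ (δ , t) → trans (map-map₃ (splits (shrink δ t)))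
                                            (trans (cong (map _) (splits-map _ t)) (map-map (splits t))))
                             (splits Γ))
             (sym (map-concatMap-map termʳ (splits Γ))))

  coassoc : ∀ x → Δ⊗id (Δ x) ∼₃ id⊗Δ (Δ x)
  coassoc x = begin
    Δ⊗id (Δ x)         ≈⟨ lin-lin ≅₃-refl Δ₀ _ x ⟩
    lin (Δ⊗id ∘ Δ₀) x  ≈⟨ lin-cong ≅₃-refl coassoc₀ x ⟩
    lin (id⊗Δ ∘ Δ₀) x  ≈⟨ lin-lin ≅₃-refl Δ₀ _ x ⟨
    id⊗Δ (Δ x)         ∎
    where open import Relation.Binary.Reasoning.Setoid (Eqv-setoid _≅₃_)

  counitˡ : ∀ x → ε⊗id (Δ x) ∼₁ x
  counitˡ x = begin
    ε⊗id (Δ x)                   ≈⟨ lin-lin ≅-refl Δ₀ (λ (a , b) → (ε₀ a , b) ∷ []) x ⟩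
    lin (ε⊗id ∘ Δ₀) x            ≈⟨ lin-cong ≅-refl counitˡ₀ x ⟩
    lin (λ Γ → (1# , Γ) ∷ []) x  ≈⟨ lin-unit ≅-refl x ⟩
    x                            ∎
    where open import Relation.Binary.Reasoning.Setoid (Eqv-setoid _≅_)

  counitʳ : ∀ x → id⊗ε (Δ x) ∼₁ x
  counitʳ x = begin
    id⊗ε (Δ x)                   ≈⟨ lin-lin ≅-refl Δ₀ (λ (a , b) → (ε₀ b , a) ∷ []) x ⟩
    lin (id⊗ε ∘ Δ₀) x            ≈⟨ lin-cong ≅-refl counitʳ₀ x ⟩
    lin (λ Γ → (1# , Γ) ∷ []) x  ≈⟨ lin-unit ≅-refl x ⟩
    x                            ∎
    where open import Relation.Binary.Reasoning.Setoid (Eqv-setoid _≅_)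

mainTheorem4 : ∀ {c ℓ} (K : Field c ℓ) → CharZero K →
    let open Coalg K in
      (∀ x y → x ∼₁ y → Δ x ∼₂ Δ y) ×
      (∀ x y → x ∼₁ y → Field._≈_ K (ε x) (ε y)) ×
      (∀ x → Δ⊗id (Δ x) ∼₃ id⊗Δ (Δ x)) ×
      (∀ x → ε⊗id (Δ x) ∼₁ x) ×
      (∀ x → id⊗ε (Δ x) ∼₁ x)
mainTheorem4 K _ =
  (λ _ _ → Δ-resp) , (λ _ _ → ε-resp) , coassoc , counitˡ , counitʳ
  where open TAGCoalgebra K
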